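{- For every string $\sigma\in(T\cup\bar{T})^*$, there exists an optimal deletion-only algorithm (one making exactly $OPT_d(\sigma)$ deletions to make $\sigma$ well-formed) of the following form: it makes a single left-to-right scan over the input, pushing each open parenthesis onto a stack; when it observes a close parenthesis, it pops the stack top if the stack top matches the observed close parenthesis (removing both from further consideration), and whenever there is a mismatch it deletes either the stack top or the observed close parenthesis.
   Context: $T$ is a finite set of open parentheses, each $x\in T$ with a unique congruent close parenthesis $\bar{x}$; a string is well-formed if it belongs to the Dyck language generated by $S\to SS\mid\varepsilon\mid aS\bar{a}$ ($a\in T$). $OPT_d(\sigma)$ is the minimum number of deletions required to make $\sigma$ well-formed. -}

module Defs where

open import Data.Nat using (ℕ; zero; suc; _≤_; _≡ᵇ_)
open import Data.Fin using (Fin)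
open import Data.List using (List; []; _∷_; _++_; [_]; length)
open import Data.Bool using (Bool; true; false; _∨_; if_then_else_)
open import Data.Product using (_×_; _,_; Σ; ∃-syntax)
open import Relation.Binary.PropositionalEquality using (_≡_; _≢_)

data Sym (n : ℕ) : Set where
  op : Fin n → Sym n
  cl : Fin n → Sym n

data WF {n : ℕ} : List (Sym n) → Set where
  wf-empty : WF []
  wf-cat   : ∀ {s t} → WF s → WF t → WF (s ++ t)
  wf-wrap  : ∀ (a : Fin n) {s} → WF s → WF (op a ∷ s ++ [ cl a ])

data Del {A : Set} : List A → List A → ℕ → Set where
  del-nil  : Del [] [] 0
  del-keep : ∀ {x σ τ k} → Del σ τ k → Del (x ∷ σ) (x ∷ τ) k
  del-drop : ∀ {x σ τ k} → Del σ τ k → Del (x ∷ σ) τ (suc k)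

IsOPTd : ∀ {n} → List (Sym n) → ℕ → Set
IsOPTd σ k =
  (∃[ τ ] (Del σ τ k × WF τ)) ×
  (∀ τ m → Del σ τ m → WF τ → k ≤ m)

number : ∀ {A : Set} → ℕ → List A → List (ℕ × A)
number i []       = []
number i (x ∷ xs) = (i , x) ∷ number (suc i) xs

elemᵇ : ℕ → List ℕ → Bool
elemᵇ i []       = false
elemᵇ i (j ∷ js) = (i ≡ᵇ j) ∨ elemᵇ i js

keptFrom : ∀ {A : Set} → List ℕ → List (ℕ × A) → List A
keptFrom D []             = []
keptFrom D ((i , x) ∷ xs) =
  if elemᵇ i D then keptFrom D xs else x ∷ keptFrom D xs

kept : ∀ {n} → List ℕ → List (Sym n) → List (Sym n)
kept D σ = keptFrom D (number 0 σ)

-- Run st inp D : starting with stack st (top first; entries are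
-- (position, open parenthesis)) and remaining position-tagged input inp,
-- some run of the algorithm deletes exactly the positions in D.
-- * open parenthesis: pushed;
-- * close parenthesis matching the stack top: both popped (kept);
-- * close parenthesis with a mismatching stack top: delete either the top
--   (then the same close parenthesis is compared with the new top) or the
--   close parenthesis;
-- * close parenthesis with an empty stack: it is deleted;
-- * at the end of the input, the remaining stack entries are deleted.
data Run {n : ℕ} : List (ℕ × Fin n) → List (ℕ × Sym n) → List ℕ → Set where
  run-done      : Run [] [] []
  run-flush     : ∀ {j a st D} → Run st [] D → Run ((j , a) ∷ st) [] (j ∷ D)
  run-push      : ∀ {i a st inp D} →
                  Run ((i , a) ∷ st) inp D → Run st ((i , op a) ∷ inp) D
  run-match     : ∀ {i j a st inp D} →
                  Run st inp D → Run ((j , a) ∷ st) ((i , cl a) ∷ inp) D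
  run-del-empty : ∀ {i b inp D} →
                  Run [] inp D → Run [] ((i , cl b) ∷ inp) (i ∷ D)
  run-del-top   : ∀ {i j a b st inp D} → a ≢ b →
                  Run st ((i , cl b) ∷ inp) D →
                  Run ((j , a) ∷ st) ((i , cl b) ∷ inp) (j ∷ D)
  run-del-close : ∀ {i j a b st inp D} → a ≢ b →
                  Run ((j , a) ∷ st) inp D →
                  Run ((j , a) ∷ st) ((i , cl b) ∷ inp) (i ∷ D)

-- The best run is computed by trying both deletions at every mismatch. It is
-- optimal by an exchange argument on an arbitrary well-formed deletion of the
-- current stack and remaining input: if the stack top and a matching close
-- parenthesis are not paired with each other in that solution, deleting their
-- partners instead and pairing them costs no more. Soundness is bookkeeping
-- of positions: the kept symbols form a balanced string and every recorded
-- position is a distinct deletion.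
module Submission where

open import Defs
open import Data.Nat using (ℕ; suc; _+_; _≤_; _<_; z≤n; s≤s; _≤?_)
open import Data.Nat.Properties
  using (≤-refl; ≤-trans; ≤-reflexive; <⇒≤; <⇒≢; n<1+n; n≤1+n; ≰⇒>; +-suc; +-mono-≤)
  renaming (_≟_ to _≟ℕ_)
open import Data.Fin using (Fin)
open import Data.Fin.Properties using (_≟_)
open import Data.List using (List; []; _∷_; _++_; [_]; length)
import Data.List as List
open import Data.List.Properties using (++-assoc)
open import Data.List.Relation.Unary.All using (All; []; _∷_)
open import Data.Bool using (true; false; if_then_else_)
open import Data.Product using (Σ; _×_; _,_; ∃-syntax; proj₁; proj₂; map; map₂)
open import Data.Empty using (⊥-elim)
open import Relation.Nullary using (Dec; yes; no)
open import Relation.Nullary.Decidable using (dec-true; dec-false)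
open import Relation.Binary.PropositionalEquality
  using (_≡_; _≢_; refl; sym; trans; cong; subst; subst₂; ≢-sym)

module _ {n : ℕ} where

  -- Bal k s: reading s while starting with stack k (top first) empties the stack.
  data Bal : List (Fin n) → List (Sym n) → Set where
    bal-nil : Bal [] []
    bal-op  : ∀ {a k s} → Bal (a ∷ k) s → Bal k (op a ∷ s)
    bal-cl  : ∀ {a k s} → Bal k s → Bal (a ∷ k) (cl a ∷ s)

  Bal-++ : ∀ {k s t} → Bal k s → Bal [] t → Bal k (s ++ t)
  Bal-++ bal-nil    t = t
  Bal-++ (bal-op b) t = bal-op (Bal-++ b t)
  Bal-++ (bal-cl b) t = bal-cl (Bal-++ b t)

  Bal-snoc : ∀ {k s a} → Bal k s → Bal (k ++ [ a ]) (s ++ [ cl a ])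
  Bal-snoc bal-nil    = bal-cl bal-nil
  Bal-snoc (bal-op b) = bal-op (Bal-snoc b)
  Bal-snoc (bal-cl b) = bal-cl (Bal-snoc b)

  wf⇒bal : ∀ {s} → WF s → Bal [] s
  wf⇒bal wf-empty      = bal-nil
  wf⇒bal (wf-cat w v)  = Bal-++ (wf⇒bal w) (wf⇒bal v)
  wf⇒bal (wf-wrap a w) = bal-op (Bal-snoc (wf⇒bal w))

  data Closing : List (Fin n) → List (Sym n) → Set where
    closing-nil  : ∀ {w} → WF w → Closing [] w
    closing-cons : ∀ {w k s a} → WF w → Closing k s → Closing (a ∷ k) (w ++ cl a ∷ s)

  closing-prepend : ∀ {v k s} → WF v → Closing k s → Closing k (v ++ s)
  closing-prepend v (closing-nil w) = closing-nil (wf-cat v w)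
  closing-prepend {v} v-wf (closing-cons {w} {k} {s} {a} w-wf c) =
    subst (Closing (a ∷ k)) (++-assoc v w (cl a ∷ s)) (closing-cons (wf-cat v-wf w-wf) c)

  closing-op : ∀ {a k s} → Closing (a ∷ k) s → Closing k (op a ∷ s)
  closing-op {a} {k} (closing-cons {w} {_} {s} w-wf c) =
    subst (Closing k) (cong (op a ∷_) (++-assoc w [ cl a ] s))
      (closing-prepend (wf-wrap a w-wf) c)

  bal⇒closing : ∀ {k s} → Bal k s → Closing k s
  bal⇒closing bal-nil    = closing-nil wf-empty
  bal⇒closing (bal-op b) = closing-op (bal⇒closing b)
  bal⇒closing (bal-cl b) = closing-cons wf-empty (bal⇒closing b)

  bal⇒wf : ∀ {s} → Bal [] s → WF s
  bal⇒wf b with bal⇒closing b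
  ... | closing-nil w = w

module _ {A : Set} where

  Del-refl : (xs : List A) → Del xs xs 0
  Del-refl []       = del-nil
  Del-refl (x ∷ xs) = del-keep (Del-refl xs)

  Del-trans : ∀ {xs ys zs : List A} {m k} → Del xs ys m → Del ys zs k → Del xs zs (k + m)
  Del-trans del-nil      del-nil      = del-nil
  Del-trans (del-keep d) (del-keep e) = del-keep (Del-trans d e)
  Del-trans (del-keep d) (del-drop e) = del-drop (Del-trans d e)
  Del-trans {k = k} (del-drop {k = m} d) e =
    subst (Del _ _) (sym (+-suc k m)) (del-drop (Del-trans d e))

  Del-drop-head : ∀ {xs : List A} {y ys m} → Del xs (y ∷ ys) m → Del xs ys (suc m)
  Del-drop-head {ys = ys} d = Del-trans d (del-drop (Del-refl ys))

-- Deleting the close parenthesis that pops the stack entry below ks.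
bal-delete-close : ∀ {n} (ks : List (Fin n)) {a k τ} →
  Bal (ks ++ a ∷ k) τ → ∃[ τ' ] (Del τ τ' 1 × Bal (ks ++ k) τ')
bal-delete-close []       (bal-op b) with bal-delete-close (_ ∷ []) b
... | τ' , d , b' = _ , del-keep d , bal-op b'
bal-delete-close (e ∷ ks) (bal-op b) with bal-delete-close (_ ∷ e ∷ ks) b
... | τ' , d , b' = _ , del-keep d , bal-op b'
bal-delete-close []       {τ = _ ∷ τ} (bal-cl b) = τ , del-drop (Del-refl τ) , b
bal-delete-close (e ∷ ks) (bal-cl b) with bal-delete-close ks b
... | τ' , d , b' = _ , del-keep d , bal-cl b'

module _ {P : List ℕ → Set} where

  cost : Σ (List ℕ) P → ℕ
  cost r = length (proj₁ r)

  shorter : Σ (List ℕ) P → Σ (List ℕ) P → Σ (List ℕ) P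
  shorter r r' with cost r ≤? cost r'
  ... | yes _ = r
  ... | no  _ = r'

  shorter-≤ˡ : (r r' : Σ (List ℕ) P) → cost (shorter r r') ≤ cost r
  shorter-≤ˡ r r' with cost r ≤? cost r'
  ... | yes _    = ≤-refl
  ... | no  r≰r' = <⇒≤ (≰⇒> r≰r')

  shorter-≤ʳ : (r r' : Σ (List ℕ) P) → cost (shorter r r') ≤ cost r'
  shorter-≤ʳ r r' with cost r ≤? cost r'
  ... | yes r≤r' = r≤r'
  ... | no  _    = ≤-refl

Runs : ∀ {n} → List (ℕ × Fin n) → List (ℕ × Sym n) → Set
Runs st inp = Σ (List ℕ) (Run st inp)

module _ {n : ℕ} {st : List (ℕ × Fin n)} {inp : List (ℕ × Sym n)} {i j : ℕ} where

  delete-top-or-close : {a b : Fin n} → a ≢ b →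
    Runs st ((i , cl b) ∷ inp) → Runs ((j , a) ∷ st) inp →
    Runs ((j , a) ∷ st) ((i , cl b) ∷ inp)
  delete-top-or-close a≢b top-deleted close-deleted =
    shorter (map (j ∷_) (run-del-top a≢b) top-deleted)
            (map (i ∷_) (run-del-close a≢b) close-deleted)

  delete-top-or-close-≤ˡ : ∀ {a b} (a≢b : a ≢ b) top-deleted close-deleted →
    cost (delete-top-or-close a≢b top-deleted close-deleted) ≤ suc (cost top-deleted)
  delete-top-or-close-≤ˡ a≢b top-deleted close-deleted =
    shorter-≤ˡ (map (j ∷_) (run-del-top a≢b) top-deleted)
               (map (i ∷_) (run-del-close a≢b) close-deleted)

  delete-top-or-close-≤ʳ : ∀ {a b} (a≢b : a ≢ b) top-deleted close-deleted →
    cost (delete-top-or-close a≢b top-deleted close-deleted) ≤ suc (cost close-deleted)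
  delete-top-or-close-≤ʳ a≢b top-deleted close-deleted =
    shorter-≤ʳ (map (j ∷_) (run-del-top a≢b) top-deleted)
               (map (i ∷_) (run-del-close a≢b) close-deleted)

  pop-or-delete : {a b : Fin n} → Dec (a ≡ b) →
    Runs st inp → Runs st ((i , cl b) ∷ inp) → Runs ((j , a) ∷ st) inp →
    Runs ((j , a) ∷ st) ((i , cl b) ∷ inp)
  pop-or-delete (yes refl) popped _   _   = map₂ run-match popped
  pop-or-delete (no a≢b)   _      top cls = delete-top-or-close a≢b top cls

best : ∀ {n} (st : List (ℕ × Fin n)) (inp : List (ℕ × Sym n)) → Runs st inp
best st             ((i , op a) ∷ inp) = map₂ run-push (best ((i , a) ∷ st) inp)
best []             []                 = [] , run-done
best ((j , a) ∷ st) []                 = map (j ∷_) run-flush (best st [])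
best []             ((i , cl b) ∷ inp) = map (i ∷_) run-del-empty (best [] inp)
best ((j , a) ∷ st) ((i , cl b) ∷ inp) =
  pop-or-delete (a ≟ b) (best st inp) (best st ((i , cl b) ∷ inp)) (best ((j , a) ∷ st) inp)

best-optimal : ∀ {n} (st : List (ℕ × Fin n)) (inp : List (ℕ × Sym n)) {k τ j m} →
  Del (List.map proj₂ st) k j → Del (List.map proj₂ inp) τ m → Bal k τ →
  cost (best st inp) ≤ j + m
best-optimal st ((i , op a) ∷ inp) dk (del-keep di) (bal-op b) =
  best-optimal ((i , a) ∷ st) inp (del-keep dk) di b
best-optimal st ((i , op a) ∷ inp) {j = j} dk (del-drop {k = m} di) b =
  ≤-trans (best-optimal ((i , a) ∷ st) inp (del-drop dk) di b) (≤-reflexive (sym (+-suc j m)))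
best-optimal [] [] del-nil del-nil bal-nil = z≤n
best-optimal (_ ∷ st) [] (del-drop dk) del-nil bal-nil =
  s≤s (best-optimal st [] dk del-nil bal-nil)
best-optimal [] ((i , cl b) ∷ inp) del-nil (del-drop di) bk =
  s≤s (best-optimal [] inp del-nil di bk)
best-optimal ((j , a) ∷ st) ((i , cl b) ∷ inp) dk di bk with a ≟ b
best-optimal (_ ∷ st) (_ ∷ inp) (del-keep dk) (del-keep di) (bal-cl bk) | yes refl =
  best-optimal st inp dk di bk
best-optimal (_ ∷ st) (_ ∷ inp) (del-drop dk) (del-drop di) bk | yes refl =
  ≤-trans (best-optimal st inp dk di bk) (+-mono-≤ (n≤1+n _) (n≤1+n _))
-- The solution pairs the kept top with a later close parenthesis: delete that one instead.
best-optimal (_ ∷ st) (_ ∷ inp) (del-keep dk) (del-drop di) bk | yes refl =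
  let _ , d , bk' = bal-delete-close [] bk in best-optimal st inp dk (Del-trans di d) bk'
-- The solution pairs the kept close parenthesis with a deeper stack entry: delete that one instead.
best-optimal (_ ∷ st) (_ ∷ inp) (del-drop dk) (del-keep di) (bal-cl bk) | yes refl =
  best-optimal st inp (Del-drop-head dk) di bk
best-optimal (_ ∷ st) (_ ∷ inp) (del-keep dk) (del-keep di) (bal-cl bk) | no a≢a =
  ⊥-elim (a≢a refl)
best-optimal (t ∷ st) (c ∷ inp) (del-drop dk) di bk | no a≢b =
  ≤-trans (delete-top-or-close-≤ˡ a≢b (best st (c ∷ inp)) (best (t ∷ st) inp))
    (s≤s (best-optimal st (c ∷ inp) dk di bk))
best-optimal (t ∷ st) (c ∷ inp) {j = j} (del-keep dk) (del-drop {k = m} di) bk | no a≢b =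
  ≤-trans (delete-top-or-close-≤ʳ a≢b (best st (c ∷ inp)) (best (t ∷ st) inp))
    (≤-trans (s≤s (best-optimal (t ∷ st) inp (del-keep dk) di bk))
             (≤-reflexive (sym (+-suc j m))))

Fresh : ∀ {A : Set} → ℕ → List (ℕ × A) → Set
Fresh q xs = All (λ e → proj₁ e ≢ q) xs

delCount : ∀ {A : Set} → List ℕ → List (ℕ × A) → ℕ
delCount D []             = 0
delCount D ((i , x) ∷ xs) = if elemᵇ i D then suc (delCount D xs) else delCount D xs

module _ {A : Set} where

  Del-keptFrom : ∀ D (xs : List (ℕ × A)) →
    Del (List.map proj₂ xs) (keptFrom D xs) (delCount D xs)
  Del-keptFrom D []             = del-nil
  Del-keptFrom D ((i , x) ∷ xs) with elemᵇ i D
  ... | true  = del-drop (Del-keptFrom D xs)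
  ... | false = del-keep (Del-keptFrom D xs)

  map-proj₂-number : ∀ i (σ : List A) → List.map proj₂ (number i σ) ≡ σ
  map-proj₂-number i []      = refl
  map-proj₂-number i (x ∷ σ) = cong (x ∷_) (map-proj₂-number (suc i) σ)

  keptFrom-skip : ∀ {p D} {xs : List (ℕ × A)} → Fresh p xs →
    keptFrom (p ∷ D) xs ≡ keptFrom D xs
  keptFrom-skip {xs = []} [] = refl
  keptFrom-skip {p} {D} {(q , x) ∷ xs} (q≢p ∷ f)
    rewrite dec-false (q ≟ℕ p) q≢p with elemᵇ q D
  ... | true  = keptFrom-skip f
  ... | false = cong (x ∷_) (keptFrom-skip f)

  keptFrom-drop : ∀ {p D x} {xs : List (ℕ × A)} → Fresh p xs →
    keptFrom (p ∷ D) ((p , x) ∷ xs) ≡ keptFrom D xs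
  keptFrom-drop {p} f rewrite dec-true (p ≟ℕ p) refl = keptFrom-skip f

  delCount-skip : ∀ {p D} {xs : List (ℕ × A)} → Fresh p xs →
    delCount (p ∷ D) xs ≡ delCount D xs
  delCount-skip {xs = []} [] = refl
  delCount-skip {p} {D} {(q , x) ∷ xs} (q≢p ∷ f)
    rewrite dec-false (q ≟ℕ p) q≢p with elemᵇ q D
  ... | true  = cong suc (delCount-skip f)
  ... | false = delCount-skip f

  delCount-drop : ∀ {p D x} {xs : List (ℕ × A)} → Fresh p xs →
    delCount (p ∷ D) ((p , x) ∷ xs) ≡ suc (delCount D xs)
  delCount-drop {p} f rewrite dec-true (p ≟ℕ p) refl = cong suc (delCount-skip f)

module _ {n : ℕ} where

  data StackBelow : ℕ → List (ℕ × Fin n) → Set where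
    below-nil  : ∀ {b} → StackBelow b []
    below-cons : ∀ {b j a st} → j < b → StackBelow j st → StackBelow b ((j , a) ∷ st)

  data NumberedFrom : ℕ → List (ℕ × Sym n) → Set where
    numbered-nil  : ∀ {i} → NumberedFrom i []
    numbered-cons : ∀ {i x xs} → NumberedFrom (suc i) xs → NumberedFrom i ((i , x) ∷ xs)

  below-weaken : ∀ {b b' st} → b ≤ b' → StackBelow b st → StackBelow b' st
  below-weaken b≤b' below-nil          = below-nil
  below-weaken b≤b' (below-cons j<b s) = below-cons (≤-trans j<b b≤b') s

  below-fresh : ∀ {b q st} → StackBelow b st → b ≤ q → Fresh q st
  below-fresh below-nil          b≤q = []
  below-fresh (below-cons j<b s) b≤q =
    <⇒≢ (≤-trans j<b b≤q) ∷ below-fresh s (<⇒≤ (≤-trans j<b b≤q))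

  numbered-fresh : ∀ {i q inp} → NumberedFrom i inp → q < i → Fresh q inp
  numbered-fresh numbered-nil       q<i = []
  numbered-fresh (numbered-cons ns) q<i =
    ≢-sym (<⇒≢ q<i) ∷ numbered-fresh ns (≤-trans q<i (n≤1+n _))

  number-numberedFrom : ∀ i (σ : List (Sym n)) → NumberedFrom i (number i σ)
  number-numberedFrom i []      = numbered-nil
  number-numberedFrom i (x ∷ σ) = numbered-cons (number-numberedFrom (suc i) σ)

  run-fresh : ∀ {st inp D q} → Run {n} st inp D → Fresh q st → Fresh q inp →
    elemᵇ q D ≡ false
  run-fresh run-done fs fi = refl
  run-fresh {q = q} (run-flush {j = j} r) (j≢q ∷ fs) fi
    rewrite dec-false (q ≟ℕ j) (≢-sym j≢q) = run-fresh r fs fi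
  run-fresh (run-push r) fs (i≢q ∷ fi) = run-fresh r (i≢q ∷ fs) fi
  run-fresh (run-match r) (_ ∷ fs) (_ ∷ fi) = run-fresh r fs fi
  run-fresh {q = q} (run-del-empty {i = i} r) fs (i≢q ∷ fi)
    rewrite dec-false (q ≟ℕ i) (≢-sym i≢q) = run-fresh r fs fi
  run-fresh {q = q} (run-del-top {j = j} _ r) (j≢q ∷ fs) fi
    rewrite dec-false (q ≟ℕ j) (≢-sym j≢q) = run-fresh r fs fi
  run-fresh {q = q} (run-del-close {i = i} _ r) fs (i≢q ∷ fi)
    rewrite dec-false (q ≟ℕ i) (≢-sym i≢q) = run-fresh r fs fi

  run-balanced : ∀ {st inp D i} → Run {n} st inp D → StackBelow i st → NumberedFrom i inp →
    Bal (keptFrom D st) (keptFrom D inp)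
  run-balanced run-done s ns = bal-nil
  run-balanced (run-flush {a = a} {D = D} r) (below-cons j<i s) ns
    rewrite keptFrom-drop {D = D} {a} (below-fresh s ≤-refl) =
    run-balanced r (below-weaken (<⇒≤ j<i) s) numbered-nil
  run-balanced {D = D} (run-push {i} r) s (numbered-cons ns)
    with elemᵇ i D | run-balanced r (below-cons (n<1+n i) s) ns
  ... | true  | b = b
  ... | false | b = bal-op b
  run-balanced (run-match {i} {j} r) (below-cons j<i s) (numbered-cons ns)
    rewrite run-fresh {q = j} r (below-fresh s ≤-refl) (numbered-fresh ns (≤-trans j<i (n≤1+n _)))
          | run-fresh {q = i} r (below-fresh s (<⇒≤ j<i)) (numbered-fresh ns (n<1+n i)) =
    bal-cl (run-balanced r (below-weaken (≤-trans (<⇒≤ j<i) (n≤1+n _)) s) ns)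
  run-balanced (run-del-empty {i} {b} {D = D} r) s (numbered-cons ns)
    rewrite keptFrom-drop {D = D} {cl b} (numbered-fresh ns (n<1+n i)) = run-balanced r below-nil ns
  run-balanced (run-del-top {a = a} {D = D} _ r) (below-cons j<i s) ns
    rewrite keptFrom-drop {D = D} {a} (below-fresh s ≤-refl)
          | keptFrom-skip {D = D} (numbered-fresh ns j<i) =
    run-balanced r (below-weaken (<⇒≤ j<i) s) ns
  run-balanced (run-del-close {i} {b = b} {D = D} _ r) s (numbered-cons ns)
    rewrite keptFrom-skip {D = D} (below-fresh s ≤-refl)
          | keptFrom-drop {D = D} {cl b} (numbered-fresh ns (n<1+n i)) =
    run-balanced r (below-weaken (n≤1+n i) s) ns

  run-deletes : ∀ {st inp D i} → Run {n} st inp D → StackBelow i st → NumberedFrom i inp →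
    delCount D st + delCount D inp ≡ length D
  run-deletes run-done s ns = refl
  run-deletes (run-flush {a = a} {D = D} r) (below-cons j<i s) ns
    rewrite delCount-drop {D = D} {a} (below-fresh s ≤-refl) =
    cong suc (run-deletes r (below-weaken (<⇒≤ j<i) s) numbered-nil)
  run-deletes {st} {D = D} (run-push {i} {inp = inp} r) s (numbered-cons ns)
    with elemᵇ i D | run-deletes r (below-cons (n<1+n i) s) ns
  ... | true  | c = trans (+-suc (delCount D st) (delCount D inp)) c
  ... | false | c = c
  run-deletes (run-match {i} {j} r) (below-cons j<i s) (numbered-cons ns)
    rewrite run-fresh {q = j} r (below-fresh s ≤-refl) (numbered-fresh ns (≤-trans j<i (n≤1+n _)))
          | run-fresh {q = i} r (below-fresh s (<⇒≤ j<i)) (numbered-fresh ns (n<1+n i)) =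
    run-deletes r (below-weaken (≤-trans (<⇒≤ j<i) (n≤1+n _)) s) ns
  run-deletes (run-del-empty {i} {b} {D = D} r) s (numbered-cons ns)
    rewrite delCount-drop {D = D} {cl b} (numbered-fresh ns (n<1+n i)) =
    cong suc (run-deletes r below-nil ns)
  run-deletes (run-del-top {a = a} {D = D} _ r) (below-cons j<i s) ns
    rewrite delCount-drop {D = D} {a} (below-fresh s ≤-refl)
          | delCount-skip {D = D} (numbered-fresh ns j<i) =
    cong suc (run-deletes r (below-weaken (<⇒≤ j<i) s) ns)
  run-deletes (run-del-close {i} {j} {a} {b} {st} {inp} {D} _ r) s (numbered-cons ns)
    rewrite delCount-skip {D = D} (below-fresh s ≤-refl)
          | delCount-drop {D = D} {cl b} (numbered-fresh ns (n<1+n i)) =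
    trans (+-suc (delCount D ((j , a) ∷ st)) (delCount D inp))
      (cong suc (run-deletes r (below-weaken (n≤1+n i) s) ns))

lemma2 : (n : ℕ) (σ : List (Sym n)) →
    ∃[ D ] (Run [] (number 0 σ) D × WF (kept D σ) × IsOPTd σ (length D))
lemma2 n σ = D , run , kept-wf , (kept D σ , kept-del , kept-wf) , optimal
  where
  inp : List (ℕ × Sym n)
  inp = number 0 σ

  D : List ℕ
  D = proj₁ (best [] inp)

  run : Run [] inp D
  run = proj₂ (best [] inp)

  kept-wf : WF (kept D σ)
  kept-wf = bal⇒wf (run-balanced run below-nil (number-numberedFrom 0 σ))

  kept-del : Del σ (kept D σ) (length D)
  kept-del = subst₂ (λ xs c → Del xs (kept D σ) c)
    (map-proj₂-number 0 σ) (run-deletes run below-nil (number-numberedFrom 0 σ))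
    (Del-keptFrom D inp)

  optimal : ∀ τ m → Del σ τ m → WF τ → length D ≤ m
  optimal τ m d w =
    best-optimal [] inp del-nil (subst (λ xs → Del xs τ m) (sym (map-proj₂-number 0 σ)) d)
      (wf⇒bal w)
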